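{- Let $\mathcal N,\mathcal N'$ be one-counter nets with control states $Q,Q'$ and let $\preceq$ be the strong simulation preorder between them. Let $(p,p')\in Q\times Q'$ and $m,m',n,n'\in\mathbb N$. If the $\preceq$-neighborhoods $NH^{(m,m')}_{\preceq}$ and $NH^{(n,n')}_{\preceq}$ agree on every argument $(q,q',l,l')\ne(p,p',0,0)$, then they also agree on $(p,p',0,0)$, i.e. $pm\preceq p'm'$ if and only if $pn\preceq p'n'$.
   Context: OCN $(Q,\mathrm{Act},\delta)$ with $\delta\subseteq Q\times\mathrm{Act}\times\{ -1,0,1\}\times Q$ induces the LTS on $Q\times\mathbb N$ with $pm\xrightarrow{a}qn$ iff $(p,a,d,q)\in\delta$, $n=m+d\ge0$. Strong simulation preorder $\preceq$: the largest relation $R\subseteq Q\times\mathbb N\times Q'\times\mathbb N$ such that for $(c,c')\in R$ and $c\xrightarrow{a}d$ there is $c'\xrightarrow{a}d'$ with $(d,d')\in R$. For a relation $R\subseteq Q\times\mathbb N\times Q'\times\mathbb N$ and $(m,m')\in\mathbb N^2$, the $R$-neighborhood $NH^{(m,m')}_R: Q\times Q'\times\{ -1,0,1\}\times\{ -1,0,1\}\to\{0,1,\bot\}$ maps $(q,q',l,l')$ to $\bot$ if $m+l<0$ or $m'+l'<0$, to $1$ if $(q(m+l),q'(m'+l'))\in R$, and to $0$ otherwise. -}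

module Defs where

open import Data.Nat using (ℕ)
open import Data.Integer using (ℤ; +_; -[1+_]; _+_; _<_) renaming (0ℤ to 0z)
open import Data.Fin using (Fin)
open import Data.List using (List)
open import Data.List.Membership.Propositional using (_∈_)
open import Data.Product using (Σ; _×_; _,_)
open import Data.Sum using (_⊎_)
open import Relation.Binary.PropositionalEquality using (_≡_)
open import Relation.Nullary using (¬_)
open import Level using (Level; suc; zero)

data Eff : Set where
  dec nop inc : Eff

effℤ : Eff → ℤ
effℤ dec = -[1+ 0 ]
effℤ nop = + 0
effℤ inc = + 1

record OCN (nAct : ℕ) : Set where
  field
    nQ : ℕ
    δ  : List (Fin nQ × Fin nAct × Eff × Fin nQ)

module _ {nAct : ℕ} where

  State : OCN nAct → Set
  State N = Fin (OCN.nQ N)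

  Step : (N : OCN nAct) → State N → ℕ → Fin nAct → State N → ℕ → Set
  Step N p m a q n = Σ Eff λ d → ((p , a , d , q) ∈ OCN.δ N) × (+ n ≡ + m + effℤ d)

  Rel : OCN nAct → OCN nAct → Set₁
  Rel N N' = State N → ℕ → State N' → ℕ → Set

  IsSimulation : (N N' : OCN nAct) → Rel N N' → Set
  IsSimulation N N' R =
    ∀ p m p' m' → R p m p' m' →
    ∀ a q n → Step N p m a q n →
    Σ (State N') λ q' → Σ ℕ λ n' → Step N' p' m' a q' n' × R q n q' n'

  -- strong simulation preorder: the largest simulation, i.e. the union of all
  -- simulations:  p m ≼ p' m'  iff some simulation contains the pair
  SimPre : (N N' : OCN nAct) → State N → ℕ → State N' → ℕ → Set₁
  SimPre N N' p m p' m' =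
    Σ (Rel N N') λ R → IsSimulation N N' R × R p m p' m'

data NHVal : Set where
  v0 v1 v⊥ : NHVal

-- NHIs R m m' q q' l l' v  :  NH^{(m,m')}_R (q,q',l,l') = v
-- (the graph of the neighborhood function, for a relation R of any level)
data NHIs {ℓ : Level} {A B : Set} (R : A → ℕ → B → ℕ → Set ℓ)
          (m m' : ℕ) (q : A) (q' : B) (l l' : Eff) : NHVal → Set ℓ where
  is⊥ : ((+ m + effℤ l) < 0z) ⊎ ((+ m' + effℤ l') < 0z) →
        NHIs R m m' q q' l l' v⊥
  is1 : (k k' : ℕ) → + k ≡ + m + effℤ l → + k' ≡ + m' + effℤ l' →
        R q k q' k' → NHIs R m m' q q' l l' v1
  is0 : (k k' : ℕ) → + k ≡ + m + effℤ l → + k' ≡ + m' + effℤ l' →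
        ¬ R q k q' k' → NHIs R m m' q q' l l' v0

-- If p m ≼ p' m', the relation obtained from ≼ by adding the pair (p n, p' n') is a
-- simulation up to ≼. A move of p n with effect d is mirrored by the same move of p m:
-- it is enabled, since otherwise the neighborhoods would differ in the value ⊥ at
-- (p, p', d, +1). Its answer from p' m' leads to a pair that the neighborhood of
-- (m, m') marks 1; off the centre this mark carries over to (n, n'), and at the centre
-- (a loop p → p answered by a loop p' → p') the answer is the loop at p' n'.
module Submission where

open import Defs
open import Data.Nat using (ℕ; zero; suc)
open import Data.Nat.Properties using (+-comm)
open import Data.Integer using (+_; -<+) renaming (_+_ to _+ℤ_; _<_ to _<ℤ_; 0ℤ to 0z)
open import Data.Integer.Properties using (+-injective; +≮0; +-identityʳ)
open import Data.Fin using (Fin) renaming (_≟_ to _≟ᶠ_)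
open import Data.Product using (Σ; _×_; _,_; proj₂)
open import Data.Sum using (_⊎_; inj₁; inj₂; map₂)
open import Data.Empty using (⊥; ⊥-elim)
open import Level using (Level)
open import Relation.Nullary using (¬_; Dec; yes; no)
open import Relation.Nullary.Decidable using (_×-dec_)
open import Relation.Binary.PropositionalEquality using (_≡_; refl; sym; trans; cong; subst)
open import Function.Bundles using (_⇔_; mk⇔; Equivalence)

isNop? : (l : Eff) → Dec (l ≡ nop)
isNop? dec = no λ ()
isNop? nop = yes refl
isNop? inc = no λ ()

nop-update : {k m : ℕ} → + k ≡ + m +ℤ effℤ nop → k ≡ m
nop-update e = +-injective (trans e (+-identityʳ _))

update-unique : {k j m : ℕ} (d : Eff) → + k ≡ + m +ℤ effℤ d → + j ≡ + m +ℤ effℤ d → k ≡ j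
update-unique d e e' = +-injective (trans e (sym e'))

update-or-negative : (m : ℕ) (d : Eff) → (Σ ℕ λ k → + k ≡ + m +ℤ effℤ d) ⊎ (+ m +ℤ effℤ d <ℤ 0z)
update-or-negative m       nop = inj₁ (m , sym (+-identityʳ (+ m)))
update-or-negative m       inc = inj₁ (suc m , cong +_ (+-comm 1 m))
update-or-negative zero    dec = inj₂ -<+
update-or-negative (suc m) dec = inj₁ (m , refl)

update-nonnegative : {k m : ℕ} (d : Eff) → + k ≡ + m +ℤ effℤ d → ¬ (+ m +ℤ effℤ d <ℤ 0z)
update-nonnegative d e neg = +≮0 (subst (_<ℤ 0z) (sym e) neg)

module _ {ℓ : Level} {A B : Set} {R : A → ℕ → B → ℕ → Set ℓ} where

  NH-⊥-inc : {m m' : ℕ} {q : A} {q' : B} {l : Eff} →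
             NHIs R m m' q q' l inc v⊥ → + m +ℤ effℤ l <ℤ 0z
  NH-⊥-inc (is⊥ (inj₁ neg)) = neg
  NH-⊥-inc (is⊥ (inj₂ neg)) = ⊥-elim (+≮0 neg)

  NH-centre : {m m' n n' : ℕ} {q : A} {q' : B} →
              (R q m q' m' → R q n q' n') → (R q n q' n' → R q m q' m') →
              (v : NHVal) → NHIs R m m' q q' nop nop v → NHIs R n n' q q' nop nop v
  NH-centre to from v (is⊥ (inj₁ neg)) = ⊥-elim (+≮0 neg)
  NH-centre to from v (is⊥ (inj₂ neg)) = ⊥-elim (+≮0 neg)
  NH-centre to from v (is1 k k' e e' r) with nop-update e | nop-update e'
  ... | refl | refl = is1 _ _ (sym (+-identityʳ _)) (sym (+-identityʳ _)) (to r)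
  NH-centre to from v (is0 k k' e e' ¬r) with nop-update e | nop-update e'
  ... | refl | refl = is0 _ _ (sym (+-identityʳ _)) (sym (+-identityʳ _)) (λ r → ¬r (from r))

module _ {nAct : ℕ} {N N' : OCN nAct} where

  Answer : {ℓ : Level} (R : State N → ℕ → State N' → ℕ → Set ℓ) →
           State N' → ℕ → Fin nAct → State N → ℕ → Set ℓ
  Answer R p' n' a q k = Σ (State N') λ q' → Σ ℕ λ k' → Step N' p' n' a q' k' × R q k q' k'

  SimPre-step : ∀ {p m p' m' a q k} → SimPre N N' p m p' m' → Step N p m a q k →
                Answer (SimPre N N') p' m' a q k
  SimPre-step (S , isS , s) st with isS _ _ _ _ s _ _ _ st
  ... | q' , k' , st' , s' = q' , k' , st' , (S , isS , s')

  Pair : State N → ℕ → State N' → ℕ → Rel N N'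
  Pair p n p' n' q k q' k' = q ≡ p × k ≡ n × q' ≡ p' × k' ≡ n'

  module UpTo (p : State N) (n : ℕ) (p' : State N') (n' : ℕ) where

    PairOrSimPre : State N → ℕ → State N' → ℕ → Set₁
    PairOrSimPre q k q' k' = Pair p n p' n' q k q' k' ⊎ SimPre N N' q k q' k'

    witness : ∀ {q k q' k'} → PairOrSimPre q k q' k' → Rel N N'
    witness (inj₁ _)           = λ _ _ _ _ → ⊥
    witness (inj₂ (S , _ , _)) = S

    witness-isSimulation : ∀ {q k q' k'} (x : PairOrSimPre q k q' k') → IsSimulation N N' (witness x)
    witness-isSimulation (inj₁ _) _ _ _ _ ()
    witness-isSimulation (inj₂ (_ , isS , _)) = isS

    witness-or-pair : ∀ {q k q' k'} (x : PairOrSimPre q k q' k') →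
                      Pair p n p' n' q k q' k' ⊎ witness x q k q' k'
    witness-or-pair (inj₁ pair)        = inj₁ pair
    witness-or-pair (inj₂ (_ , _ , s)) = inj₂ s

    module _ (answer : ∀ {a q k} → Step N p n a q k → Answer PairOrSimPre p' n' a q k) where

      Move : Set
      Move = Σ (Fin nAct) λ a → Σ (State N) λ q → Σ ℕ λ k → Step N p n a q k

      answerOf : Move → Rel N N'
      answerOf (_ , _ , _ , st) = witness (answer st .proj₂ .proj₂ .proj₂)

      -- SimPre is Set₁-valued, so instead of adding all of it we add the union of the
      -- chosen witness simulations, indexed by the (small) set of moves.
      PairOrAnswers : Rel N N'
      PairOrAnswers q k q' k' = Pair p n p' n' q k q' k' ⊎ Σ Move λ i → answerOf i q k q' k'

      PairOrAnswers-isSimulation : IsSimulation N N' PairOrAnswers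
      PairOrAnswers-isSimulation _ _ _ _ (inj₂ (i@(_ , _ , _ , st) , s)) a q k st'
        with witness-isSimulation (answer st .proj₂ .proj₂ .proj₂) _ _ _ _ s a q k st'
      ... | q' , k' , st″ , s' = q' , k' , st″ , inj₂ (i , s')
      PairOrAnswers-isSimulation _ _ _ _ (inj₁ (refl , refl , refl , refl)) a q k st =
        let (q' , k' , st' , x) = answer st in
        q' , k' , st' , map₂ (λ s → (a , q , k , st) , s) (witness-or-pair x)

      SimPre-upTo : SimPre N N' p n p' n'
      SimPre-upTo = PairOrAnswers , PairOrAnswers-isSimulation , inj₁ (refl , refl , refl , refl)

module Transfer {nAct : ℕ} (N N' : OCN nAct) (p : State N) (p' : State N') (m m' n n' : ℕ)
  (agree : (q : State N) (q' : State N') (l l' : Eff) →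
           ¬ ((q ≡ p) × (q' ≡ p') × (l ≡ nop) × (l' ≡ nop)) →
           (v : NHVal) → NHIs (SimPre N N') m m' q q' l l' v → NHIs (SimPre N N') n n' q q' l l' v)
  where

  source-update : ∀ {k} d → + k ≡ + n +ℤ effℤ d → Σ ℕ λ j → + j ≡ + m +ℤ effℤ d
  source-update d e with update-or-negative m d
  ... | inj₁ update = update
  ... | inj₂ neg    = ⊥-elim (update-nonnegative d e (NH-⊥-inc
                        (agree p p' d inc (λ { (_ , _ , _ , ()) }) v⊥ (is⊥ (inj₁ neg)))))

  transfer : SimPre N N' p m p' m' → SimPre N N' p n p' n'
  transfer sim = UpTo.SimPre-upTo p n p' n' answer
    where
    answer : ∀ {a q k} → Step N p n a q k →
             Answer {N = N} {N' = N'} (UpTo.PairOrSimPre p n p' n') p' n' a q k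
    answer {q = q} (d , δ∋ , e) with source-update d e
    ... | j , e₁ with SimPre-step sim (d , δ∋ , e₁)
    ... | q' , j' , (d' , δ'∋ , e₁') , sim₁
      with (q ≟ᶠ p) ×-dec (q' ≟ᶠ p') ×-dec isNop? d ×-dec isNop? d'
    ... | yes (refl , refl , refl , refl) =
      p' , n' , (nop , δ'∋ , sym (+-identityʳ _)) , inj₁ (refl , nop-update e , refl , refl)
    ... | no off with agree q q' d d' off v1 (is1 j j' e₁ e₁' sim₁)
    ... | is1 k k' f f' sim₂ =
      q' , k' , (d' , δ'∋ , f') , inj₂ (subst (λ x → SimPre N N' q x q' k') (update-unique d f e) sim₂)

lemma4p14 : {nAct : ℕ} (N N' : OCN nAct) (p : State N) (p' : State N') (m m' n n' : ℕ) →
    ((q : State N) (q' : State N') (l l' : Eff) →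
      ¬ ((q ≡ p) × (q' ≡ p') × (l ≡ nop) × (l' ≡ nop)) →
      (v : NHVal) →
      NHIs (SimPre N N') m m' q q' l l' v ⇔ NHIs (SimPre N N') n n' q q' l l' v) →
    ((v : NHVal) →
      NHIs (SimPre N N') m m' p p' nop nop v ⇔ NHIs (SimPre N N') n n' p p' nop nop v)
    × (SimPre N N' p m p' m' ⇔ SimPre N N' p n p' n')
lemma4p14 N N' p p' m m' n n' agree =
  (λ v → mk⇔ (NH-centre to from v) (NH-centre from to v)) , mk⇔ to from
  where
  to : SimPre N N' p m p' m' → SimPre N N' p n p' n'
  to = Transfer.transfer N N' p p' m m' n n' λ q q' l l' off v → Equivalence.to (agree q q' l l' off v)

  from : SimPre N N' p n p' n' → SimPre N N' p m p' m'
  from = Transfer.transfer N N' p p' n n' m m' λ q q' l l' off v → Equivalence.from (agree q q' l l' off v)
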